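{- For $n\ge1$ let $\mathcal{W}_n$ be the parity game with vertex set $\{v_1,\dots,v_{2n},u_0,u_1\}$ defined as follows. For $1\le i\le n$: $v_i$ is owned by $\Diamond$, has priority $i+2$, and successors $v_{n+i}$ and $v_{i-1}$ if $i>1$, and $u_0$ if $i=1$; $v_{n+i}$ is owned by $\Box$, has priority $i+2$, and successors $v_i$ and $v_{n+i-1}$ if $i>1$, and $u_1$ if $i=1$. Vertex $u_0$ is owned by $\Diamond$, has priority $0$ and only successor $u_0$; $u_1$ is owned by $\Box$, has priority $1$ and only successor $u_1$. Then in $\mathcal{W}_n$ the vertices $u_0,v_1,\dots,v_n$ are won by player $\Diamond$ and the vertices $u_1,v_{n+1},\dots,v_{2n}$ are won by player $\Box$.
   Context: A parity game consists of a finite vertex set partitioned into vertices owned by player even ($\Diamond$) and player odd ($\Box$), a total edge relation and a priority function into $\mathbb{N}$. A token is moved along edges forever, the owner of the current vertex choosing the successor; $\Diamond$ wins an infinite play iff the highest priority occurring infinitely often is even. A vertex is won by a player if that player has a strategy such that every play from the vertex consistent with it is won by that player. -}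

module Defs where

open import Data.Nat using (ℕ; zero; suc; _+_; _≤_)
open import Data.Nat using (_%_)
open import Data.Fin using (Fin; zero; suc; toℕ; inject₁)
open import Data.Product using (Σ; _×_; ∃; _,_; proj₁)
open import Relation.Binary.PropositionalEquality using (_≡_)

Even : ℕ → Set
Even p = p % 2 ≡ 0

Odd : ℕ → Set
Odd p = p % 2 ≡ 1

data Player : Set where
  ◇ : Player
  □ : Player

record ParityGame : Set₁ where
  field
    V        : Set
    owner    : V → Player
    E        : V → V → Set
    priority : V → ℕ

module _ (G : ParityGame) where
  open ParityGame G

  record Play (v : V) : Set where
    field
      π      : ℕ → V
      start  : π 0 ≡ v
      moves  : ∀ i → E (π i) (π (suc i))
  open Play

  -- a (history-dependent) strategy for player P: given the history
  -- (the k vertices visited before) and the current vertex owned by P,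
  -- choose a successor along an edge
  Strategy : Player → Set
  Strategy P = (k : ℕ) → (Fin k → V) → (c : V) → owner c ≡ P → Σ V (E c)

  Consistent : {P : Player} {v : V} → Strategy P → Play v → Set
  Consistent {P} σ ρ =
    ∀ i → (o : owner (π ρ i) ≡ P) →
      π ρ (suc i) ≡ proj₁ (σ i (λ j → π ρ (toℕ j)) (π ρ i) o)

  MaxInfOften : {v : V} → Play v → ℕ → Set
  MaxInfOften ρ p =
    (∀ i → ∃ λ j → i ≤ j × priority (π ρ j) ≡ p) ×
    (∃ λ N → ∀ j → N ≤ j → priority (π ρ j) ≤ p)

  WinsPlay : Player → {v : V} → Play v → Set
  WinsPlay ◇ ρ = ∃ λ p → Even p × MaxInfOften ρ p
  WinsPlay □ ρ = ∃ λ p → Odd p × MaxInfOften ρ p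

  Wins : Player → V → Set
  Wins P v = Σ (Strategy P) λ σ → (ρ : Play v) → Consistent σ ρ → WinsPlay P ρ

-- The game W_n.  vD i (i : Fin n) is v_{i+1}, vB i is v_{n+i+1}.

data WV (n : ℕ) : Set where
  vD : Fin n → WV n
  vB : Fin n → WV n
  u0 : WV n
  u1 : WV n

W-owner : ∀ {n} → WV n → Player
W-owner (vD _) = ◇
W-owner (vB _) = □
W-owner u0     = ◇
W-owner u1     = □

W-priority : ∀ {n} → WV n → ℕ
W-priority (vD i) = toℕ i + 3
W-priority (vB i) = toℕ i + 3
W-priority u0     = 0
W-priority u1     = 1

data W-edge : ∀ {n} → WV n → WV n → Set where
  vD→vB  : ∀ {n} (i : Fin n) → W-edge (vD i) (vB i)
  vB→vD  : ∀ {n} (i : Fin n) → W-edge (vB i) (vD i)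
  vD→vD  : ∀ {n} (i : Fin n) → W-edge (vD (suc i)) (vD (inject₁ i))
  vB→vB  : ∀ {n} (i : Fin n) → W-edge (vB (suc i)) (vB (inject₁ i))
  vD₁→u0 : ∀ {n} → W-edge {suc n} (vD zero) u0
  vB₁→u1 : ∀ {n} → W-edge {suc n} (vB zero) u1
  u0→u0  : ∀ {n} → W-edge {n} u0 u0
  u1→u1  : ∀ {n} → W-edge {n} u1 u1

W : ℕ → ParityGame
W n = record { V = WV n ; owner = W-owner ; E = W-edge ; priority = W-priority }

-- Each player wins every vertex they own by always moving one rung down their own
-- ladder: the play is trapped among that player's vertices, and after at most n
-- steps it reaches the self-loop u0 (priority 0) or u1 (priority 1) and stays there.
module Submission where

open import Defs
open import Data.Nat using (ℕ; zero; suc; pred; _∸_; _+_; _≤_)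
open import Data.Nat.Properties using (pred[m∸n]≡m∸[1+n]; m≤n⇒m∸n≡0; m≤m+n; m≤n+m; ≤-reflexive)
open import Data.Fin using (Fin; zero; suc; toℕ; inject₁)
open import Data.Fin.Properties using (toℕ-inject₁)
open import Data.Product using (_×_; _,_)
open import Relation.Binary.PropositionalEquality using (_≡_; refl; trans; cong; module ≡-Reasoning)

module _ (G : ParityGame) where
  open ParityGame G

  eventually-constant⇒MaxInfOften : ∀ {v} (ρ : Play G v) {p} N →
    (∀ j → N ≤ j → priority (Play.π ρ j) ≡ p) → MaxInfOften G ρ p
  eventually-constant⇒MaxInfOften ρ N const =
    (λ i → i + N , m≤m+n i N , const (i + N) (m≤n+m N i)) ,
    (N , λ j N≤j → ≤-reflexive (const j N≤j))

parity : Player → ℕ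
parity ◇ = 0
parity □ = 1

MaxInfOften-parity⇒WinsPlay : ∀ {G v} P (ρ : Play G v) →
  MaxInfOften G ρ (parity P) → WinsPlay G P ρ
MaxInfOften-parity⇒WinsPlay ◇ ρ max = 0 , refl , max
MaxInfOften-parity⇒WinsPlay □ ρ max = 1 , refl , max

module _ {n : ℕ} where

  descend : WV n → WV n
  descend (vD zero)    = u0
  descend (vD (suc i)) = vD (inject₁ i)
  descend (vB zero)    = u1
  descend (vB (suc i)) = vB (inject₁ i)
  descend u0           = u0
  descend u1           = u1

  descend-edge : ∀ c → W-edge c (descend c)
  descend-edge (vD zero)    = vD₁→u0
  descend-edge (vD (suc i)) = vD→vD i
  descend-edge (vB zero)    = vB₁→u1
  descend-edge (vB (suc i)) = vB→vB i
  descend-edge u0           = u0→u0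
  descend-edge u1           = u1→u1

  descend-owner : ∀ c → W-owner (descend c) ≡ W-owner c
  descend-owner (vD zero)    = refl
  descend-owner (vD (suc i)) = refl
  descend-owner (vB zero)    = refl
  descend-owner (vB (suc i)) = refl
  descend-owner u0           = refl
  descend-owner u1           = refl

  height : WV n → ℕ
  height (vD i) = suc (toℕ i)
  height (vB i) = suc (toℕ i)
  height u0     = 0
  height u1     = 0

  height-descend : ∀ c → height (descend c) ≡ pred (height c)
  height-descend (vD zero)    = refl
  height-descend (vD (suc i)) = cong suc (toℕ-inject₁ i)
  height-descend (vB zero)    = refl
  height-descend (vB (suc i)) = cong suc (toℕ-inject₁ i)
  height-descend u0           = refl
  height-descend u1           = refl

  height≡0⇒priority≡parity : ∀ c → height c ≡ 0 → W-priority c ≡ parity (W-owner c)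
  height≡0⇒priority≡parity u0 _ = refl
  height≡0⇒priority≡parity u1 _ = refl

  descending : (P : Player) → Strategy (W n) P
  descending P _ _ c _ = descend c , descend-edge c

  owner-wins : ∀ v → Wins (W n) (W-owner v) v
  owner-wins v = descending P , λ ρ consistent →
      MaxInfOften-parity⇒WinsPlay P ρ
        (eventually-constant⇒MaxInfOften (W n) ρ (height v) (settled ρ consistent))
    where
    P : Player
    P = W-owner v

    module _ (ρ : Play (W n) v) (consistent : Consistent (W n) (descending P) ρ) where
      open Play ρ

      owned : ∀ j → W-owner (π j) ≡ P
      steps : ∀ j → π (suc j) ≡ descend (π j)

      owned zero    = cong W-owner start
      owned (suc j) = begin
        W-owner (π (suc j))     ≡⟨ cong W-owner (steps j) ⟩
        W-owner (descend (π j)) ≡⟨ descend-owner (π j) ⟩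
        W-owner (π j)           ≡⟨ owned j ⟩
        P                       ∎
        where open ≡-Reasoning
      steps j = consistent j (owned j)

      height-π : ∀ j → height (π j) ≡ height v ∸ j
      height-π zero    = cong height start
      height-π (suc j) = begin
        height (π (suc j))     ≡⟨ cong height (steps j) ⟩
        height (descend (π j)) ≡⟨ height-descend (π j) ⟩
        pred (height (π j))    ≡⟨ cong pred (height-π j) ⟩
        pred (height v ∸ j)    ≡⟨ pred[m∸n]≡m∸[1+n] (height v) j ⟩
        height v ∸ suc j       ∎
        where open ≡-Reasoning

      settled : ∀ j → height v ≤ j → W-priority (π j) ≡ parity P
      settled j h≤j = begin
        W-priority (π j)         ≡⟨ height≡0⇒priority≡parity (π j) (trans (height-π j) (m≤n⇒m∸n≡0 h≤j)) ⟩
        parity (W-owner (π j))   ≡⟨ cong parity (owned j) ⟩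
        parity P                 ∎
        where open ≡-Reasoning

lemma4 : (n : ℕ) → 1 ≤ n →
    (Wins (W n) ◇ u0 × ((i : Fin n) → Wins (W n) ◇ (vD i))) ×
    (Wins (W n) □ u1 × ((i : Fin n) → Wins (W n) □ (vB i)))
lemma4 n _ =
  (owner-wins u0 , λ i → owner-wins (vD i)) ,
  (owner-wins u1 , λ i → owner-wins (vB i))
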